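{- For every nontrivial irreducible type $\tau$ of width $k$ whose block decomposition has $b$ blocks, and every integer $n\ge b$, there is a graph homomorphism $\phi\colon G(n,\sigma_{b-1})\to G(kn,\tau)$, where $\sigma_{m}$ denotes the type $1\,3\cdots3\,2$ consisting of a $1$, followed by $m-1$ threes, followed by a $2$.
   Context: For finite sets $X,Y\subseteq\mathbb{Q}$ with $X\cup Y=\{z_1<\dots<z_\ell\}$, the order type $\tau(X,Y)$ is the sequence $(\tau_1,\dots,\tau_\ell)$ with $\tau_i=1$ if $z_i\in X\setminus Y$, $2$ if $z_i\in Y\setminus X$, $3$ if $z_i\in X\cap Y$. A type of width $k$ is the order type of a pair $(X,Y)$ with $|X|=|Y|=k$. A type is trivial if all its entries equal $3$. A nonempty type is irreducible if it is not the concatenation of two nonempty types; a nontrivial irreducible type is primary if it starts with $1$ and secondary if it starts with $2$. For a finite sequence $B$ of ones, twos and threes, $\mathbf{1}(B)$ is the number of entries equal to $1$ or $3$ and $\mathbf{2}(B)$ the number equal to $2$ or $3$. Block decomposition of a primary irreducible type $\tau$: the first block $B_1$ consists of all initial ones; once $B_i$ is constructed, $B_{i+1}$ consists of the next consecutive entries such that $\mathbf{2}(B_{i+1})=\mathbf{1}(B_i)$ and, subject to this, $B_{i+1}$ is as long as possible; stop when all entries are placed, giving $\tau=B_1\cdots B_b$. For a secondary irreducible type, interchange ones and twos, decompose, and interchange back (same number of blocks). For a nontrivial type $\tau$ of width $k$ and $N\ge k$, the type-graph $G(N,\tau)$ has vertex set $\binom{[N]}{k}$, with $X,Y$ adjacent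 iff $\tau(X,Y)=\tau$ or $\tau(Y,X)=\tau$. -}

module Defs where

open import Data.Nat using (ℕ; zero; suc; _+_; _∸_; _<_; _≤_)
open import Data.List using (List; []; _∷_; _++_; length; replicate; map)
open import Data.List.Relation.Unary.All using (All)
open import Data.Vec using (Vec; []; _∷_)
open import Data.Fin.Subset using (Subset; Side; inside; outside; ∣_∣)
open import Data.Product using (Σ; ∃; ∃-syntax; _×_; _,_; proj₁)
open import Data.Sum using (_⊎_)
open import Relation.Binary.PropositionalEquality using (_≡_; _≢_)
open import Relation.Nullary using (¬_)

data Entry : Set where
  one two three : Entry

Type : Set
Type = List Entry

cell : Side → Side → Type
cell inside  outside = one ∷ []
cell outside inside  = two ∷ []
cell inside  inside  = three ∷ []
cell outside outside = []

-- Order type τ(X,Y) of two subsets of [N] = {0,…,N-1} (read in increasing order).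
orderType : ∀ {N} → Subset N → Subset N → Type
orderType []       []       = []
orderType (x ∷ xs) (y ∷ ys) = cell x y ++ orderType xs ys

IsTypeOfWidth : ℕ → Type → Set
IsTypeOfWidth k τ =
  ∃[ N ] Σ (Subset N) λ X → Σ (Subset N) λ Y →
    ∣ X ∣ ≡ k × ∣ Y ∣ ≡ k × orderType X Y ≡ τ

IsType : Type → Set
IsType τ = ∃[ k ] IsTypeOfWidth k τ

Trivial : Type → Set
Trivial τ = All (_≡ three) τ

Nontrivial : Type → Set
Nontrivial τ = ¬ Trivial τ

Irreducible : Type → Set
Irreducible τ =
  τ ≢ [] ×
  ¬ (Σ Type λ σ → Σ Type λ ρ →
       σ ≢ [] × ρ ≢ [] × IsType σ × IsType ρ × σ ++ ρ ≡ τ)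

ones : Type → ℕ
ones []          = 0
ones (one ∷ B)   = suc (ones B)
ones (two ∷ B)   = ones B
ones (three ∷ B) = suc (ones B)

twos : Type → ℕ
twos []          = 0
twos (one ∷ B)   = twos B
twos (two ∷ B)   = suc (twos B)
twos (three ∷ B) = suc (twos B)

LongestPrefixWithTwos : ℕ → Type → Type → Set
LongestPrefixWithTwos t rest B =
  (Σ Type λ r → B ++ r ≡ rest) × twos B ≡ t ×
  (∀ B′ r′ → B′ ++ r′ ≡ rest → length B < length B′ → twos B′ ≢ t)

-- BlocksFrom prev rest Bs : starting after the block `prev`, the remaining
-- entries `rest` are split into the blocks Bs by the greedy rule
-- (stop exactly when all entries are placed).
data BlocksFrom (prev : Type) : Type → List Type → Set where
  done : BlocksFrom prev [] []
  step : ∀ {e es} B rest Bs →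
         B ++ rest ≡ e ∷ es →
         LongestPrefixWithTwos (ones prev) (e ∷ es) B →
         BlocksFrom B rest Bs →
         BlocksFrom prev (e ∷ es) (B ∷ Bs)

data PrimaryBlockDecomposition : Type → List Type → Set where
  decomp : ∀ B₁ rest Bs →
           All (_≡ one) B₁ →
           ¬ (Σ Type λ r → rest ≡ one ∷ r) →
           BlocksFrom B₁ rest Bs →
           PrimaryBlockDecomposition (B₁ ++ rest) (B₁ ∷ Bs)

swapEntry : Entry → Entry
swapEntry one   = two
swapEntry two   = one
swapEntry three = three

swapType : Type → Type
swapType = map swapEntry

BlockDecomposition : Type → List Type → Set
BlockDecomposition τ Bs =
  (Σ Type (λ r → τ ≡ one ∷ r) × PrimaryBlockDecomposition τ Bs) ⊎
  (Σ Type (λ r → τ ≡ two ∷ r) × PrimaryBlockDecomposition (swapType τ) (map swapType Bs))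

σ : ℕ → Type
σ m = one ∷ replicate (m ∸ 1) three ++ two ∷ []

Vertex : ℕ → ℕ → Set
Vertex N k = Σ (Subset N) λ X → ∣ X ∣ ≡ k

Adjacent : ∀ {N k} → Type → Vertex N k → Vertex N k → Set
Adjacent τ (X , _) (Y , _) = orderType X Y ≡ τ ⊎ orderType Y X ≡ τ

GraphHom : (N₁ k₁ : ℕ) (τ₁ : Type) (N₂ k₂ : ℕ) (τ₂ : Type) → Set
GraphHom N₁ k₁ τ₁ N₂ k₂ τ₂ =
  Σ (Vertex N₁ k₁ → Vertex N₂ k₂) λ φ →
    ∀ x y → Adjacent τ₁ x y → Adjacent τ₂ (φ x) (φ y)

-- Write τ = B₁ ⋯ B_b.  Since 𝟐(B_{i+1}) = 𝟏(B_i), one can build sets P₀, P₁, …, P_b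
-- of a common finite ordered set with τ(P_i, P_{i-1}) = B_i and P₀ = ∅: each new set
-- is obtained by inserting fresh points next to the previous one.  Counting 𝟏(τ) = 𝟐(τ)
-- forces P_b = ∅, and at most k points are used, so P_i ⊆ [k].  Now send a
-- (b-1)-set S ⊆ [n] to the subset of [n] × [k] ≅ [kn] that carries a copy of P_i over
-- the i-th element of S.  If τ(S, T) = σ_{b-1}, the elements of S ∪ T contribute
-- τ(P₁, ∅), τ(P₂, P₁), …, τ(∅, P_{b-1}) in turn, i.e. exactly τ.
module Submission where

open import Defs
open import Data.Nat using (ℕ; zero; suc; _+_; _*_; _∸_; _≤_; z≤n; s≤s)
open import Data.Nat.Properties
  using (+-assoc; +-suc; +-identityʳ; +-cancelˡ-≡; +-monoˡ-≤; ≤-refl; ≤-reflexive; ≤-trans; m≤n⇒m≤1+n; *-comm; suc-injective)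
open import Data.Nat.ListAction using (sum)
open import Data.List using (List; []; _∷_; _++_; length; replicate; map; concat)
open import Data.List.Properties using (++-assoc; ++-identityʳ; length-map)
open import Data.List.Relation.Unary.All using (All; []; _∷_)
open import Data.Vec using ([]; _∷_) renaming (_++_ to _++ᵛ_)
open import Data.Fin.Subset using (Subset; Side; inside; outside; ∣_∣; ⊥)
open import Data.Fin.Subset.Properties using (∣⊥∣≡0)
open import Data.Product using (Σ; ∃; _×_; _,_; -,_; proj₁; proj₂)
open import Data.Sum using (inj₁; inj₂)
open import Relation.Binary.PropositionalEquality
open ≡-Reasoning

ones-++ : ∀ xs ys → ones (xs ++ ys) ≡ ones xs + ones ys
ones-++ []           ys = refl
ones-++ (one ∷ xs)   ys = cong suc (ones-++ xs ys)
ones-++ (two ∷ xs)   ys = ones-++ xs ys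
ones-++ (three ∷ xs) ys = cong suc (ones-++ xs ys)

twos-++ : ∀ xs ys → twos (xs ++ ys) ≡ twos xs + twos ys
twos-++ []           ys = refl
twos-++ (one ∷ xs)   ys = twos-++ xs ys
twos-++ (two ∷ xs)   ys = cong suc (twos-++ xs ys)
twos-++ (three ∷ xs) ys = cong suc (twos-++ xs ys)

ones-swapType : ∀ τ → ones (swapType τ) ≡ twos τ
ones-swapType []          = refl
ones-swapType (one ∷ τ)   = ones-swapType τ
ones-swapType (two ∷ τ)   = cong suc (ones-swapType τ)
ones-swapType (three ∷ τ) = cong suc (ones-swapType τ)

twos-swapType : ∀ τ → twos (swapType τ) ≡ ones τ
twos-swapType []          = refl
twos-swapType (one ∷ τ)   = cong suc (twos-swapType τ)
twos-swapType (two ∷ τ)   = twos-swapType τ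
twos-swapType (three ∷ τ) = cong suc (twos-swapType τ)

swapType-involutive : ∀ τ → swapType (swapType τ) ≡ τ
swapType-involutive []          = refl
swapType-involutive (one ∷ τ)   = cong (one ∷_) (swapType-involutive τ)
swapType-involutive (two ∷ τ)   = cong (two ∷_) (swapType-involutive τ)
swapType-involutive (three ∷ τ) = cong (three ∷_) (swapType-involutive τ)

ones-orderType : ∀ {N} (X Y : Subset N) → ones (orderType X Y) ≡ ∣ X ∣
ones-orderType []            []            = refl
ones-orderType (inside ∷ X)  (inside ∷ Y)  = cong suc (ones-orderType X Y)
ones-orderType (inside ∷ X)  (outside ∷ Y) = cong suc (ones-orderType X Y)
ones-orderType (outside ∷ X) (inside ∷ Y)  = ones-orderType X Y
ones-orderType (outside ∷ X) (outside ∷ Y) = ones-orderType X Y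

orderType-swap : ∀ {N} (X Y : Subset N) → orderType Y X ≡ swapType (orderType X Y)
orderType-swap []            []            = refl
orderType-swap (inside ∷ X)  (inside ∷ Y)  = cong (three ∷_) (orderType-swap X Y)
orderType-swap (inside ∷ X)  (outside ∷ Y) = cong (two ∷_) (orderType-swap X Y)
orderType-swap (outside ∷ X) (inside ∷ Y)  = cong (one ∷_) (orderType-swap X Y)
orderType-swap (outside ∷ X) (outside ∷ Y) = orderType-swap X Y

twos-orderType : ∀ {N} (X Y : Subset N) → twos (orderType X Y) ≡ ∣ Y ∣
twos-orderType X Y = begin
  twos (orderType X Y)            ≡⟨ cong twos (orderType-swap Y X) ⟩
  twos (swapType (orderType Y X)) ≡⟨ twos-swapType (orderType Y X) ⟩
  ones (orderType Y X)            ≡⟨ ones-orderType Y X ⟩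
  ∣ Y ∣                           ∎

orderType-++ : ∀ {m n} (X X′ : Subset m) (Y Y′ : Subset n) →
  orderType (X ++ᵛ Y) (X′ ++ᵛ Y′) ≡ orderType X X′ ++ orderType Y Y′
orderType-++ []      []        Y Y′ = refl
orderType-++ (x ∷ X) (x′ ∷ X′) Y Y′ = begin
  cell x x′ ++ orderType (X ++ᵛ Y) (X′ ++ᵛ Y′)      ≡⟨ cong (cell x x′ ++_) (orderType-++ X X′ Y Y′) ⟩
  cell x x′ ++ (orderType X X′ ++ orderType Y Y′)   ≡⟨ ++-assoc (cell x x′) _ _ ⟨
  (cell x x′ ++ orderType X X′) ++ orderType Y Y′   ∎

orderType-⊥ : ∀ n → orderType (⊥ {n}) ⊥ ≡ []
orderType-⊥ zero    = refl
orderType-⊥ (suc n) = orderType-⊥ n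

∣++∣ : ∀ {m n} (X : Subset m) (Y : Subset n) → ∣ X ++ᵛ Y ∣ ≡ ∣ X ∣ + ∣ Y ∣
∣++∣ []            Y = refl
∣++∣ (inside ∷ X)  Y = cong suc (∣++∣ X Y)
∣++∣ (outside ∷ X) Y = ∣++∣ X Y

∣p∣≡0⇒p≡⊥ : ∀ {n} {p : Subset n} → ∣ p ∣ ≡ 0 → p ≡ ⊥
∣p∣≡0⇒p≡⊥ {p = []}          _     = refl
∣p∣≡0⇒p≡⊥ {p = outside ∷ p} ∣p∣≡0 = cong (outside ∷_) (∣p∣≡0⇒p≡⊥ ∣p∣≡0)

width-ones : ∀ {k τ} → IsTypeOfWidth k τ → ones τ ≡ k
width-ones (_ , X , Y , ∣X∣≡k , _ , refl) = trans (ones-orderType X Y) ∣X∣≡k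

width-twos : ∀ {k τ} → IsTypeOfWidth k τ → twos τ ≡ k
width-twos (_ , X , Y , _ , ∣Y∣≡k , refl) = trans (twos-orderType X Y) ∣Y∣≡k

TypePreserving : ℕ → ℕ → Set
TypePreserving K L = Σ (Subset K → Subset L) λ f → ∀ u v → orderType (f u) (f v) ≡ orderType u v

_∘ᵗ_ : ∀ {K L M} → TypePreserving L M → TypePreserving K L → TypePreserving K M
(g , g-pres) ∘ᵗ (f , f-pres) = (λ u → g (f u)) , λ u v → trans (g-pres (f u) (f v)) (f-pres u v)

castᵗ : ∀ {K L} → K ≡ L → TypePreserving K L
castᵗ refl = (λ u → u) , λ _ _ → refl

∣∣-preserved : ∀ {K L} ((f , _) : TypePreserving K L) (u : Subset K) → ∣ f u ∣ ≡ ∣ u ∣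
∣∣-preserved (f , f-pres) u = begin
  ∣ f u ∣                      ≡⟨ ones-orderType (f u) (f u) ⟨
  ones (orderType (f u) (f u)) ≡⟨ cong ones (f-pres u u) ⟩
  ones (orderType u u)         ≡⟨ ones-orderType u u ⟩
  ∣ u ∣                        ∎

-- An insertion embeds [K] into [L] in order, adding L ∸ K new points; the set
-- `inserted ι` contains all new points and the old points marked inside.
data Insertion : ℕ → ℕ → Set where
  []   : Insertion 0 0
  keep : ∀ {K L} → Side → Insertion K L → Insertion (suc K) (suc L)
  new  : ∀ {K L} → Insertion K L → Insertion K (suc L)

embed : ∀ {K L} → Insertion K L → Subset K → Subset L
embed []         []      = []
embed (keep _ ι) (x ∷ u) = x ∷ embed ι u
embed (new ι)    u       = outside ∷ embed ι u

inserted : ∀ {K L} → Insertion K L → Subset L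
inserted []         = []
inserted (keep s ι) = s ∷ inserted ι
inserted (new ι)    = inside ∷ inserted ι

orderType-embed : ∀ {K L} (ι : Insertion K L) (u v : Subset K) →
  orderType (embed ι u) (embed ι v) ≡ orderType u v
orderType-embed []         []      []      = refl
orderType-embed (keep _ ι) (x ∷ u) (y ∷ v) = cong (cell x y ++_) (orderType-embed ι u v)
orderType-embed (new ι)    u       v       = orderType-embed ι u v

embedᵗ : ∀ {K L} → Insertion K L → TypePreserving K L
embedᵗ ι = embed ι , orderType-embed ι

insertAll : ∀ m → Insertion 0 m
insertAll zero    = []
insertAll (suc m) = new (insertAll m)

padding : ∀ {K L} → K ≤ L → Insertion K L
padding {L = L} z≤n = insertAll L
padding (s≤s K≤L)   = keep outside (padding K≤L)

-- The insertion turning v into a set w with τ(w, v) = W: ones of W become new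
-- points, twos and threes consume the points of v in order.  The clause for
-- W = [] with v still nonempty is junk (then twos W ≢ ∣ v ∣).
insertionFor : ∀ {K} → Subset K → Type → ∃ (Insertion K)
insertionFor []            W           = -, insertAll (ones W)
insertionFor (outside ∷ v) W           = -, keep outside (proj₂ (insertionFor v W))
insertionFor (inside ∷ v)  []          = -, keep outside (proj₂ (insertionFor v []))
insertionFor (inside ∷ v)  (one ∷ W)   = -, new (proj₂ (insertionFor (inside ∷ v) W))
insertionFor (inside ∷ v)  (two ∷ W)   = -, keep outside (proj₂ (insertionFor v W))
insertionFor (inside ∷ v)  (three ∷ W) = -, keep inside (proj₂ (insertionFor v W))

insertionFor-size : ∀ {K} (v : Subset K) W → proj₁ (insertionFor v W) ≤ K + ones W
insertionFor-size []            W = ≤-refl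
insertionFor-size (outside ∷ v) W = s≤s (insertionFor-size v W)
insertionFor-size (inside ∷ v)  [] = s≤s (insertionFor-size v [])
insertionFor-size {suc K} (inside ∷ v) (one ∷ W) rewrite +-suc K (ones W) =
  s≤s (insertionFor-size (inside ∷ v) W)
insertionFor-size (inside ∷ v)  (two ∷ W) = s≤s (insertionFor-size v W)
insertionFor-size {suc K} (inside ∷ v) (three ∷ W) rewrite +-suc K (ones W) =
  s≤s (m≤n⇒m≤1+n (insertionFor-size v W))

orderType-insertionFor : ∀ {K} (v : Subset K) W → twos W ≡ ∣ v ∣ →
  let ι = proj₂ (insertionFor v W) in orderType (inserted ι) (embed ι v) ≡ W
orderType-insertionFor []            W           twos≡ = only-ones W twos≡
  where
  only-ones : ∀ W → twos W ≡ 0 →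
    orderType (inserted (insertAll (ones W))) (embed (insertAll (ones W)) []) ≡ W
  only-ones []        _     = refl
  only-ones (one ∷ W) twos≡ = cong (one ∷_) (only-ones W twos≡)
orderType-insertionFor (outside ∷ v) W           twos≡ = orderType-insertionFor v W twos≡
orderType-insertionFor (inside ∷ v)  (one ∷ W)   twos≡ =
  cong (one ∷_) (orderType-insertionFor (inside ∷ v) W twos≡)
orderType-insertionFor (inside ∷ v)  (two ∷ W)   twos≡ =
  cong (two ∷_) (orderType-insertionFor v W (suc-injective twos≡))
orderType-insertionFor (inside ∷ v)  (three ∷ W) twos≡ =
  cong (three ∷_) (orderType-insertionFor v W (suc-injective twos≡))

blocks : ∀ {K} → Subset K → List (Subset K) → Subset K → List Type
blocks p []       l = orderType l p ∷ []
blocks p (q ∷ qs) l = orderType q p ∷ blocks q qs l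

length-blocks : ∀ {K} (p : Subset K) qs l → length (blocks p qs l) ≡ suc (length qs)
length-blocks p []       l = refl
length-blocks p (q ∷ qs) l = cong suc (length-blocks q qs l)

blocks-preserved : ∀ {K L} ((f , f-pres) : TypePreserving K L) (p : Subset K) qs l →
  blocks (f p) (map f qs) (f l) ≡ blocks p qs l
blocks-preserved (f , f-pres) p []       l = cong (_∷ []) (f-pres l p)
blocks-preserved (f , f-pres) p (q ∷ qs) l =
  cong₂ _∷_ (f-pres q p) (blocks-preserved (f , f-pres) q qs l)

ones-concat-blocks : ∀ {K} (p : Subset K) qs l →
  ones (concat (blocks p qs l)) ≡ sum (map ∣_∣ qs) + ∣ l ∣
ones-concat-blocks p [] l = begin
  ones (orderType l p ++ []) ≡⟨ cong ones (++-identityʳ (orderType l p)) ⟩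
  ones (orderType l p)       ≡⟨ ones-orderType l p ⟩
  ∣ l ∣                      ∎
ones-concat-blocks p (q ∷ qs) l = begin
  ones (orderType q p ++ concat (blocks q qs l))      ≡⟨ ones-++ (orderType q p) _ ⟩
  ones (orderType q p) + ones (concat (blocks q qs l)) ≡⟨ cong₂ _+_ (ones-orderType q p) (ones-concat-blocks q qs l) ⟩
  ∣ q ∣ + (sum (map ∣_∣ qs) + ∣ l ∣)                  ≡⟨ +-assoc ∣ q ∣ _ _ ⟨
  ∣ q ∣ + sum (map ∣_∣ qs) + ∣ l ∣                    ∎

twos-concat-blocks : ∀ {K} (p : Subset K) qs l →
  twos (concat (blocks p qs l)) ≡ ∣ p ∣ + sum (map ∣_∣ qs)
twos-concat-blocks p [] l = begin
  twos (orderType l p ++ []) ≡⟨ cong twos (++-identityʳ (orderType l p)) ⟩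
  twos (orderType l p)       ≡⟨ twos-orderType l p ⟩
  ∣ p ∣                      ≡⟨ +-identityʳ ∣ p ∣ ⟨
  ∣ p ∣ + 0                  ∎
twos-concat-blocks p (q ∷ qs) l = begin
  twos (orderType q p ++ concat (blocks q qs l))       ≡⟨ twos-++ (orderType q p) _ ⟩
  twos (orderType q p) + twos (concat (blocks q qs l)) ≡⟨ cong₂ _+_ (twos-orderType q p) (twos-concat-blocks q qs l) ⟩
  ∣ p ∣ + (∣ q ∣ + sum (map ∣_∣ qs))                   ∎

-- Counting 𝟏 = 𝟐 over all blocks shows that a chain starting at ∅ also ends at ∅.
blocks-closed : ∀ {K} {p : Subset K} {qs l Bs} → ∣ p ∣ ≡ 0 → blocks p qs l ≡ Bs →
  ones (concat Bs) ≡ twos (concat Bs) → blocks ⊥ qs ⊥ ≡ Bs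
blocks-closed {p = p} {qs} {l} ∣p∣≡0 refl balanced =
  sym (cong₂ (λ p′ l′ → blocks p′ qs l′) (∣p∣≡0⇒p≡⊥ ∣p∣≡0) (∣p∣≡0⇒p≡⊥ ∣l∣≡0))
  where
  Σqs : ℕ
  Σqs = sum (map ∣_∣ qs)
  ∣l∣≡0 : ∣ l ∣ ≡ 0
  ∣l∣≡0 = +-cancelˡ-≡ Σqs ∣ l ∣ 0 (begin
    Σqs + ∣ l ∣                   ≡⟨ ones-concat-blocks p qs l ⟨
    ones (concat (blocks p qs l)) ≡⟨ balanced ⟩
    twos (concat (blocks p qs l)) ≡⟨ twos-concat-blocks p qs l ⟩
    ∣ p ∣ + Σqs                   ≡⟨ cong (_+ Σqs) ∣p∣≡0 ⟩
    Σqs                           ≡⟨ +-identityʳ Σqs ⟨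
    Σqs + 0                       ∎)

data Linked : ℕ → List Type → Set where
  []  : ∀ {t} → Linked t []
  _∷_ : ∀ {t B Bs} → twos B ≡ t → Linked (ones B) Bs → Linked t (B ∷ Bs)

BlocksFrom⇒Linked : ∀ {prev rest Bs} → BlocksFrom prev rest Bs → Linked (ones prev) Bs
BlocksFrom⇒Linked done                                  = []
BlocksFrom⇒Linked (step _ _ _ _ (_ , twos≡ , _) blocks) = twos≡ ∷ BlocksFrom⇒Linked blocks

concat-BlocksFrom : ∀ {prev rest Bs} → BlocksFrom prev rest Bs → concat Bs ≡ rest
concat-BlocksFrom done                      = refl
concat-BlocksFrom (step B _ _ ++≡ _ blocks) = trans (cong (B ++_) (concat-BlocksFrom blocks)) ++≡

record ChainFrom {K : ℕ} (v : Subset K) (Bs : List Type) : Set where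
  field
    L         : ℕ
    L≤        : L ≤ K + ones (concat Bs)
    embedding : TypePreserving K L
    inner     : List (Subset L)
    final     : Subset L
    blocks≡   : blocks (proj₁ embedding v) inner final ≡ Bs

chainFrom : ∀ {K B Bs} (v : Subset K) → Linked ∣ v ∣ (B ∷ Bs) → ChainFrom v (B ∷ Bs)
chainFrom {K} {B} v (twos≡ ∷ []) = record
  { L         = proj₁ (insertionFor v B)
  ; L≤        = subst (λ W → proj₁ (insertionFor v B) ≤ K + ones W) (sym (++-identityʳ B)) (insertionFor-size v B)
  ; embedding = embedᵗ ι
  ; inner     = []
  ; final     = inserted ι
  ; blocks≡   = cong (_∷ []) (orderType-insertionFor v B twos≡)
  }
  where
  ι : Insertion K (proj₁ (insertionFor v B))
  ι = proj₂ (insertionFor v B)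
chainFrom {K} {B} {Bs} v (twos≡ ∷ linked@(_ ∷ _)) = record
  { L         = L
  ; L≤        = ≤-trans L≤ (≤-trans (+-monoˡ-≤ (ones (concat Bs)) (insertionFor-size v B)) ≤-sum)
  ; embedding = embedding ∘ᵗ embedᵗ ι
  ; inner     = proj₁ embedding w ∷ inner
  ; final     = final
  ; blocks≡   = cong₂ _∷_ (trans (proj₂ embedding w (embed ι v)) w-realizes) blocks≡
  }
  where
  ι : Insertion K (proj₁ (insertionFor v B))
  ι = proj₂ (insertionFor v B)
  w : Subset (proj₁ (insertionFor v B))
  w = inserted ι
  w-realizes : orderType w (embed ι v) ≡ B
  w-realizes = orderType-insertionFor v B twos≡
  ∣w∣≡ : ones B ≡ ∣ w ∣
  ∣w∣≡ = trans (sym (cong ones w-realizes)) (ones-orderType w (embed ι v))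
  ≤-sum : K + ones B + ones (concat Bs) ≤ K + ones (B ++ concat Bs)
  ≤-sum = ≤-reflexive (trans (+-assoc K (ones B) _) (cong (K +_) (sym (ones-++ B (concat Bs)))))
  open ChainFrom (chainFrom w (subst (λ t → Linked t Bs) ∣w∣≡ linked))

Realization : ℕ → Type → ℕ → Set
Realization k τ m = Σ (List (Subset k)) λ ps → length ps ≡ m × concat (blocks ⊥ ps ⊥) ≡ τ

primaryRealization : ∀ {k τ Bs} → ones τ ≡ k → twos τ ≡ k →
  PrimaryBlockDecomposition τ Bs → Realization k τ (length Bs ∸ 1)
primaryRealization {k} ones≡k twos≡k (decomp B₁ rest Bs initial-ones _ blocksFrom) =
  ps , length-ps , trans (cong concat closed) concat≡τ
  where
  twos-B₁ : ∀ {B} → All (_≡ one) B → twos B ≡ 0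
  twos-B₁ []           = refl
  twos-B₁ (refl ∷ all) = twos-B₁ all
  open ChainFrom (chainFrom {B = B₁} [] (twos-B₁ initial-ones ∷ BlocksFrom⇒Linked blocksFrom))
  concat≡τ : concat (B₁ ∷ Bs) ≡ B₁ ++ rest
  concat≡τ = cong (B₁ ++_) (concat-BlocksFrom blocksFrom)
  pad : TypePreserving L k
  pad = embedᵗ (padding (subst (L ≤_) (trans (cong ones concat≡τ) ones≡k) L≤))
  ps : List (Subset k)
  ps = map (proj₁ pad) inner
  padded : blocks (proj₁ (pad ∘ᵗ embedding) []) ps (proj₁ pad final) ≡ B₁ ∷ Bs
  padded = trans (blocks-preserved pad _ inner final) blocks≡
  balanced : ones (concat (B₁ ∷ Bs)) ≡ twos (concat (B₁ ∷ Bs))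
  balanced = begin
    ones (concat (B₁ ∷ Bs)) ≡⟨ cong ones concat≡τ ⟩
    ones (B₁ ++ rest)       ≡⟨ ones≡k ⟩
    k                       ≡⟨ twos≡k ⟨
    twos (B₁ ++ rest)       ≡⟨ cong twos concat≡τ ⟨
    twos (concat (B₁ ∷ Bs)) ∎
  closed : blocks ⊥ ps ⊥ ≡ B₁ ∷ Bs
  closed = blocks-closed (∣∣-preserved (pad ∘ᵗ embedding) []) padded balanced
  length-ps : length ps ≡ length Bs
  length-ps = suc-injective (trans (sym (length-blocks ⊥ ps ⊥)) (cong length closed))

module _ {k : ℕ} where

  -- Pattern lists are read with junk values: first [] = ⊥ and others [] = [].
  first : List (Subset k) → Subset k
  first []      = ⊥
  first (p ∷ _) = p

  others : List (Subset k) → List (Subset k)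
  others []       = []
  others (_ ∷ ps) = ps

  inflate : ∀ {n} → List (Subset k) → Subset n → Subset (n * k)
  inflate ps []            = []
  inflate ps (outside ∷ S) = ⊥ ++ᵛ inflate ps S
  inflate ps (inside ∷ S)  = first ps ++ᵛ inflate (others ps) S

  inflateType : List (Subset k) → List (Subset k) → Type → Type
  inflateType ps qs []          = []
  inflateType ps qs (one ∷ w)   = orderType (first ps) ⊥ ++ inflateType (others ps) qs w
  inflateType ps qs (two ∷ w)   = orderType ⊥ (first qs) ++ inflateType ps (others qs) w
  inflateType ps qs (three ∷ w) = orderType (first ps) (first qs) ++ inflateType (others ps) (others qs) w

  orderType-inflate : ∀ {n} ps qs (S T : Subset n) →
    orderType (inflate ps S) (inflate qs T) ≡ inflateType ps qs (orderType S T)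
  orderType-inflate ps qs []            []            = refl
  orderType-inflate ps qs (outside ∷ S) (outside ∷ T) = begin
    orderType (⊥ {k} ++ᵛ inflate ps S) (⊥ ++ᵛ inflate qs T)     ≡⟨ orderType-++ (⊥ {k}) ⊥ (inflate ps S) (inflate qs T) ⟩
    orderType (⊥ {k}) ⊥ ++ orderType (inflate ps S) (inflate qs T) ≡⟨ cong (_++ orderType (inflate ps S) (inflate qs T)) (orderType-⊥ k) ⟩
    orderType (inflate ps S) (inflate qs T)                     ≡⟨ orderType-inflate ps qs S T ⟩
    inflateType ps qs (orderType S T)                           ∎
  orderType-inflate ps qs (inside ∷ S)  (outside ∷ T) =
    trans (orderType-++ (first ps) ⊥ (inflate (others ps) S) (inflate qs T))
          (cong (orderType (first ps) ⊥ ++_) (orderType-inflate (others ps) qs S T))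
  orderType-inflate ps qs (outside ∷ S) (inside ∷ T)  =
    trans (orderType-++ ⊥ (first qs) (inflate ps S) (inflate (others qs) T))
          (cong (orderType ⊥ (first qs) ++_) (orderType-inflate ps (others qs) S T))
  orderType-inflate ps qs (inside ∷ S)  (inside ∷ T)  =
    trans (orderType-++ (first ps) (first qs) (inflate (others ps) S) (inflate (others qs) T))
          (cong (orderType (first ps) (first qs) ++_) (orderType-inflate (others ps) (others qs) S T))

  ∣inflate∣ : ∀ {n} ps (S : Subset n) → length ps ≡ ∣ S ∣ → ∣ inflate ps S ∣ ≡ sum (map ∣_∣ ps)
  ∣inflate∣ []       []            _       = refl
  ∣inflate∣ ps       (outside ∷ S) length≡ =
    trans (∣++∣ (⊥ {k}) (inflate ps S)) (cong₂ _+_ (∣⊥∣≡0 k) (∣inflate∣ ps S length≡))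
  ∣inflate∣ (p ∷ ps) (inside ∷ S)  length≡ =
    trans (∣++∣ p (inflate ps S)) (cong (∣ p ∣ +_) (∣inflate∣ ps S (suc-injective length≡)))

  inflateType-σ : ∀ ps → inflateType ps ps (σ (length ps)) ≡ concat (blocks ⊥ ps ⊥)
  inflateType-σ []       rewrite orderType-⊥ k = refl
  inflateType-σ (p ∷ ps) = cong (orderType p ⊥ ++_) (threes-two p ps)
    where
    threes-two : ∀ p ps →
      inflateType ps (p ∷ ps) (replicate (length ps) three ++ two ∷ []) ≡ concat (blocks p ps ⊥)
    threes-two p []       = refl
    threes-two p (q ∷ ps) = cong (orderType q p ++_) (threes-two q ps)

inflateHom : ∀ n {k τ m} → twos τ ≡ k → Realization k τ m → GraphHom n m (σ m) (k * n) k τ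
inflateHom n {k} {τ} twos≡k (ps , refl , realizes) = φ , φ-adjacent
  where
  E : TypePreserving (n * k) (k * n)
  E = castᵗ (*-comm n k)
  Σps≡k : sum (map ∣_∣ ps) ≡ k
  Σps≡k = begin
    sum (map ∣_∣ ps)                ≡⟨ cong (_+ sum (map ∣_∣ ps)) (∣⊥∣≡0 k) ⟨
    ∣ ⊥ {k} ∣ + sum (map ∣_∣ ps)    ≡⟨ twos-concat-blocks ⊥ ps ⊥ ⟨
    twos (concat (blocks ⊥ ps ⊥))   ≡⟨ cong twos realizes ⟩
    twos τ                          ≡⟨ twos≡k ⟩
    k                               ∎
  φ : Vertex n (length ps) → Vertex (k * n) k
  φ (S , ∣S∣≡m) = proj₁ E (inflate ps S) ,
    trans (∣∣-preserved E (inflate ps S)) (trans (∣inflate∣ ps S (sym ∣S∣≡m)) Σps≡k)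
  σ-to-τ : ∀ S T → orderType S T ≡ σ (length ps) → orderType (proj₁ E (inflate ps S)) (proj₁ E (inflate ps T)) ≡ τ
  σ-to-τ S T σ≡ = begin
    orderType (proj₁ E (inflate ps S)) (proj₁ E (inflate ps T)) ≡⟨ proj₂ E (inflate ps S) (inflate ps T) ⟩
    orderType (inflate ps S) (inflate ps T)                     ≡⟨ orderType-inflate ps ps S T ⟩
    inflateType ps ps (orderType S T)                           ≡⟨ cong (inflateType ps ps) σ≡ ⟩
    inflateType ps ps (σ (length ps))                           ≡⟨ inflateType-σ ps ⟩
    concat (blocks ⊥ ps ⊥)                                      ≡⟨ realizes ⟩
    τ                                                           ∎
  φ-adjacent : ∀ x y → Adjacent (σ (length ps)) x y → Adjacent τ (φ x) (φ y)
  φ-adjacent (S , _) (T , _) (inj₁ σ≡) = inj₁ (σ-to-τ S T σ≡)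
  φ-adjacent (S , _) (T , _) (inj₂ σ≡) = inj₂ (σ-to-τ T S σ≡)

swapHom : ∀ {n a s N k} τ → GraphHom n a s N k (swapType τ) → GraphHom n a s N k τ
swapHom τ (φ , φ-adjacent) = φ , λ x y x~y → unswap (φ x) (φ y) (φ-adjacent x y x~y)
  where
  swapped : ∀ {N} (X Y : Subset N) → orderType X Y ≡ swapType τ → orderType Y X ≡ τ
  swapped X Y eq = trans (orderType-swap X Y) (trans (cong swapType eq) (swapType-involutive τ))
  unswap : ∀ {N k} (u v : Vertex N k) → Adjacent (swapType τ) u v → Adjacent τ u v
  unswap (X , _) (Y , _) (inj₁ eq) = inj₂ (swapped X Y eq)
  unswap (X , _) (Y , _) (inj₂ eq) = inj₁ (swapped Y X eq)

-- Nontriviality and irreducibility only make the block decomposition exist, and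
-- b ≤ n only excludes edgeless source graphs: the construction needs none of them.
proposition3p1 : (k : ℕ) (τ : Type) → IsTypeOfWidth k τ → Nontrivial τ → Irreducible τ →
    (Bs : List Type) (b : ℕ) → BlockDecomposition τ Bs → length Bs ≡ b →
    (n : ℕ) → b ≤ n →
    GraphHom n (b ∸ 1) (σ (b ∸ 1)) (k * n) k τ
proposition3p1 k τ width _ _ Bs _ (inj₁ (_ , primary)) refl n _ =
  inflateHom n (width-twos width) (primaryRealization (width-ones width) (width-twos width) primary)
proposition3p1 k τ width _ _ Bs _ (inj₂ (_ , swappedPrimary)) refl n _ =
  swapHom τ (inflateHom n twos≡k (subst (Realization k (swapType τ)) (cong (_∸ 1) (length-map swapType Bs))
    (primaryRealization ones≡k twos≡k swappedPrimary)))
  where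
  ones≡k : ones (swapType τ) ≡ k
  ones≡k = trans (ones-swapType τ) (width-twos width)
  twos≡k : twos (swapType τ) ≡ k
  twos≡k = trans (twos-swapType τ) (width-ones width)
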